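{- There is an absolute constant $\epsilon_0>0$ such that the following holds. Let $n\ge4$, let $\mathcal{F}\subset S_n$ with $|\mathcal{F}|=n!/2$, $f=2\chi_{\mathcal{F}}-1$, $f_1$ its orthogonal projection onto $U_1$, $\epsilon=\mathbb{E}[(f-f_1)^2]$, and assume $n^{ -7/3}\le\epsilon<\epsilon_0$. Let $a_{ij}=(n-1)\langle f,T_{ij}\rangle$. Suppose $(X,Y)$ is a typical restriction, and write $g_1=g_1(X,Y)$, $g_2=g_2(X,Y)$. Choose $\alpha,\beta$ independently and uniformly at random from $T_{X,Y}$. Then with probability at least $1-8\epsilon^{2/7}$, one of the following holds: (a) $|g_1(\alpha)-g_1(\beta)|\le2\epsilon^{1/7}$ and $|g_2(\alpha)-g_2(\beta)|\le2\epsilon^{1/7}$; (b) $|g_1(\alpha)-g_1(\beta)|\le2\epsilon^{1/7}$ and $\big||g_2(\alpha)-g_2(\beta)|-2\big|\le2\epsilon^{1/7}$; (c) $\big||g_1(\alpha)-g_1(\beta)|-2\big|\le2\epsilon^{1/7}$ and $|g_2(\alpha)-g_2(\beta)|\le2\epsilon^{1/7}$.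
   Context: $S_n$ is the symmetric group on $[n]$; $T_{ij}=\{\sigma:\sigma(i)=j\}$ (also its characteristic function); $U_1=\mathrm{span}\{T_{ij}\}$ with inner product $\langle f,g\rangle=\frac1{n!}\sum_\pi f(\pi)g(\pi)$. A restriction is a pair $X,Y\subset[n]$ with $|X|=|Y|$; $T_{X,Y}=\{\pi\in S_n:\pi(X)=Y\}$. For $\pi\in T_{X,Y}$: $g_1(X,Y)(\pi)=\sum_{i\in X}a_{i\pi(i)}$, $g_2(X,Y)(\pi)=\sum_{i\notin X}a_{i\pi(i)}$, $g(X,Y)=g_1(X,Y)+g_2(X,Y)$. A function $\phi$ on a probability space is $(\delta,\epsilon)$-almost Boolean if $\Pr[||\phi|-1|\le\epsilon]\ge1-\delta$. A restriction $(X,Y)$ is typical if, with respect to the uniform measure on $T_{X,Y}$: (a) $g(X,Y)$ is $(\epsilon^{4/7},\epsilon^{1/7})$-almost Boolean; (b) $|\mathbb{E}[g_1(X,Y)]|\le\epsilon^{1/7}$ and $|\mathbb{E}[g_2(X,Y)]|\le\epsilon^{1/7}$; (c) $\mathbb{E}[(|g(X,Y)|-1)^2]\le\epsilon^{6/7}$. -}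

module Defs where

open import Data.Bool using (Bool; true; false; if_then_else_; _∧_; _∨_; not; T)
open import Data.Nat as ℕ using (ℕ; zero; suc)
open import Data.Integer using (+_)
open import Data.Fin using (Fin)
open import Data.Fin.Properties using (_≟_)
open import Data.Fin.Subset using (Subset)
open import Data.Vec using (Vec; []; _∷_; lookup)
open import Data.List using (List; []; _∷_; [_]; map; concatMap; allFin; filterᵇ; length; foldr; cartesianProduct)
open import Data.Product using (_×_; _,_; proj₁; proj₂)
open import Data.Rational using (ℚ; 0ℚ; 1ℚ; _+_; _*_; _-_; _/_; ∣_∣; _≤ᵇ_)
open import Relation.Nullary.Decidable using (⌊_⌋)
open import Relation.Binary.PropositionalEquality using (_≡_)

ℕ→ℚ : ℕ → ℚ
ℕ→ℚ n = + n / 1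

_^_ : ℚ → ℕ → ℚ
x ^ zero  = 1ℚ
x ^ suc k = x * (x ^ k)

sumℚ : List ℚ → ℚ
sumℚ = foldr _+_ 0ℚ

Σfin : (n : ℕ) → (Fin n → ℚ) → ℚ
Σfin n f = sumℚ (map f (allFin n))

-- expectation of φ w.r.t. the uniform measure on the (finite) list L
-- (defined to be 0 on the empty list; never used there)
𝔼 : {A : Set} → List A → (A → ℚ) → ℚ
𝔼 [] φ = 0ℚ
𝔼 (x ∷ xs) φ = sumℚ (map φ (x ∷ xs)) * (+ 1 / suc (length xs))

Pr : {A : Set} → List A → (A → Bool) → ℚ
Pr L E = 𝔼 L (λ a → if E a then 1ℚ else 0ℚ)

-- Comparisons with fractional powers  c · ε^(k/m)  (c ≥ 0, ε > 0, m ≥ 1)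
-- "x ≤ c · ε^(k/m)"  ⇔  x ≤ 0  or  x^m ≤ c^m · ε^k
-- (both sides nonnegative in the second case, so this is exact).

≤rootᵇ : (c : ℚ) (k m : ℕ) (ε : ℚ) (x : ℚ) → Bool
≤rootᵇ c k m ε x = (x ≤ᵇ 0ℚ) ∨ ((x ^ m) ≤ᵇ ((c ^ m) * (ε ^ k)))

-- A permutation is represented by its map  Fin n → Fin n;
-- S n is the list of all injective (hence bijective) such maps,
-- each occurring exactly once (up to pointwise equality).

vecs : (m k : ℕ) → List (Vec (Fin m) k)
vecs m zero    = [ [] ]
vecs m (suc k) = concatMap (λ i → map (i ∷_) (vecs m k)) (allFin m)

_==_ : {n : ℕ} → Fin n → Fin n → Bool
i == j = ⌊ i ≟ j ⌋

allᵇ : {A : Set} → List A → (A → Bool) → Bool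
allᵇ L p = foldr (λ a b → p a ∧ b) true L

Perm : ℕ → Set
Perm n = Fin n → Fin n

injectiveᵇ : {n : ℕ} → Perm n → Bool
injectiveᵇ {n} π =
  allᵇ (allFin n) λ i → allᵇ (allFin n) λ j → (i == j) ∨ not (π i == π j)

S : (n : ℕ) → List (Perm n)
S n = filterᵇ injectiveᵇ (map lookup (vecs n n))

⟨_,_⟩ : {n : ℕ} → (Perm n → ℚ) → (Perm n → ℚ) → ℚ
⟨_,_⟩ {n} f g = 𝔼 (S n) (λ π → f π * g π)

Tχ : {n : ℕ} → Fin n → Fin n → Perm n → ℚ
Tχ i j π = if π i == j then 1ℚ else 0ℚ

card : {n : ℕ} → (Perm n → Bool) → ℕ
card {n} ℱ = length (filterᵇ ℱ (S n))

fOf : {n : ℕ} → (Perm n → Bool) → Perm n → ℚ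
fOf ℱ π = if ℱ π then 1ℚ else (0ℚ - 1ℚ)

-- element of U₁ = span{T_ij} with coefficients c
spanT : {n : ℕ} → (Fin n → Fin n → ℚ) → Perm n → ℚ
spanT {n} c π = Σfin n λ i → Σfin n λ j → c i j * Tχ i j π

IsProjU₁ : {n : ℕ} → (Perm n → ℚ) → (Fin n → Fin n → ℚ) → Set
IsProjU₁ f c = ∀ i j → ⟨ (λ π → f π - spanT c π) , Tχ i j ⟩ ≡ 0ℚ

_⇔ᵇ_ : Bool → Bool → Bool
true  ⇔ᵇ b = b
false ⇔ᵇ b = not b

-- T_{X,Y} = {π ∈ S_n : π(X) = Y}.  For a permutation π,
-- π(X) = Y  ⇔  ∀ i, (i ∈ X ⇔ π i ∈ Y).
TXY : {n : ℕ} → Subset n → Subset n → List (Perm n)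
TXY {n} X Y = filterᵇ (λ π → allᵇ (allFin n) λ i → lookup X i ⇔ᵇ lookup Y (π i)) (S n)

g₁ : {n : ℕ} → (Fin n → Fin n → ℚ) → Subset n → Perm n → ℚ
g₁ {n} a X π = Σfin n λ i → if lookup X i then a i (π i) else 0ℚ

g₂ : {n : ℕ} → (Fin n → Fin n → ℚ) → Subset n → Perm n → ℚ
g₂ {n} a X π = Σfin n λ i → if lookup X i then 0ℚ else a i (π i)

gXY : {n : ℕ} → (Fin n → Fin n → ℚ) → Subset n → Perm n → ℚ
gXY a X π = g₁ a X π + g₂ a X π

AlmostBooleanRoot : {A : Set} → List A → (A → ℚ) → (ε : ℚ) → (k₁ m₁ k₂ m₂ : ℕ) → Set
AlmostBooleanRoot L φ ε k₁ m₁ k₂ m₂ =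
  T (≤rootᵇ 1ℚ k₁ m₁ ε (1ℚ - Pr L (λ x → ≤rootᵇ 1ℚ k₂ m₂ ε (∣ ∣ φ x ∣ - 1ℚ ∣))))

Typical : {n : ℕ} → (Fin n → Fin n → ℚ) → (ε : ℚ) → Subset n → Subset n → Set
Typical a ε X Y =
  AlmostBooleanRoot (TXY X Y) (gXY a X) ε 4 7 1 7
  × T (≤rootᵇ 1ℚ 1 7 ε ∣ 𝔼 (TXY X Y) (g₁ a X) ∣)
  × T (≤rootᵇ 1ℚ 1 7 ε ∣ 𝔼 (TXY X Y) (g₂ a X) ∣)
  × T (≤rootᵇ 1ℚ 6 7 ε (𝔼 (TXY X Y) (λ π → (∣ gXY a X π ∣ - 1ℚ) ^ 2)))

goodPair : {n : ℕ} → (Fin n → Fin n → ℚ) → (ε : ℚ) → Subset n → Perm n × Perm n → Bool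
goodPair a ε X (α , β) =
  (small d₁ ∧ small d₂) ∨ (small d₁ ∧ small (∣ d₂ - two ∣)) ∨ (small (∣ d₁ - two ∣) ∧ small d₂)
  where
    two = 1ℚ + 1ℚ
    small = ≤rootᵇ two 1 7 ε
    d₁ = ∣ g₁ a X α - g₁ a X β ∣
    d₂ = ∣ g₂ a X α - g₂ a X β ∣

module Submission where

-- For α, β ∈ T_{X,Y} let γ agree with α on X and with β off X, and δ the other way round. Then
-- γ, δ ∈ T_{X,Y}, g(γ) = g₁(α) + g₂(β), g(δ) = g₁(β) + g₂(α), and (α, β) ↦ (γ, δ) is an involution
-- of T_{X,Y}², so it preserves the uniform measure. Suppose g is within ε^{1/7} < 1/2 of a sign
-- ±1 at all four of α, β, γ, δ. Then g₁(α) − g₁(β) = g(γ) − g(β) = g(α) − g(δ) and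
-- g₂(α) − g₂(β) = g(α) − g(γ) are within 2ε^{1/7} of differences of signs, i.e. of 0 or ±2; the
-- two approximations of g₁(α) − g₁(β) must agree, which rules out both differences being near ±2.
-- So a pair fails (a)–(c) only if g is far from ±1 at one of α, β, γ, δ, and by typicality (a)
-- and the union bound this has probability at most 4ε^{4/7} ≤ 8ε^{2/7}.

open import Data.Bool using (Bool; true; false; T; not; _∧_; _∨_; if_then_else_)
import Data.Bool.Properties as Bool
open import Data.Bool.Properties using (T-∧; T-∨)
open import Data.Empty using (⊥-elim)
open import Data.Fin as Fin using (Fin)
open import Data.Fin.Subset as Subset using (Subset)
import Data.Integer as ℤ
import Data.Integer.Properties as ℤ
open import Data.List using (List; []; _∷_; map; concatMap; filterᵇ; length; cartesianProduct; _++_; allFin)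
open import Data.List.Properties using (length-++; length-map)
open import Data.List.Relation.Unary.All using (All; []; _∷_)
import Data.List.Relation.Unary.All.Properties as All
open import Data.Nat as ℕ using (ℕ; zero; suc; z≤n; s≤s; _!)
import Data.Nat.Properties as ℕ
open import Data.Product using (Σ; ∃; _×_; _,_; proj₁; proj₂)
open import Data.Rational
open import Data.Rational.Properties
open import Data.Rational.Unnormalised as ℚᵘ using (mkℚᵘ; *≡*)
import Data.Rational.Unnormalised.Properties as ℚᵘ
open import Data.Sum as Sum using (_⊎_; inj₁; inj₂)
open import Data.Unit using (tt)
open import Data.Vec using (Vec; []; _∷_; lookup)
open import Function using (_∘_; _⇔_; mk⇔; Equivalence)
open import Function.Definitions using (Injective)
open import Level using (0ℓ)
open import Relation.Binary.PropositionalEquality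
open import Relation.Nullary using (yes; no)
open import Relation.Nullary.Decidable using (dec⇒maybe; toWitness; toWitnessFalse; fromWitnessFalse)
open import Tactic.RingSolver using (solve-∀)
open import Tactic.RingSolver.Core.AlmostCommutativeRing using (AlmostCommutativeRing; fromCommutativeRing)

open import Defs

ℚ-ring : AlmostCommutativeRing 0ℓ 0ℓ
ℚ-ring = fromCommutativeRing +-*-commutativeRing (λ x → dec⇒maybe (0ℚ ≟ x))

fromℚᵘ-+ : ∀ p q → fromℚᵘ (p ℚᵘ.+ q) ≡ fromℚᵘ p + fromℚᵘ q
fromℚᵘ-+ p q = toℚᵘ-injective (ℚᵘ.≃-trans (toℚᵘ-fromℚᵘ (p ℚᵘ.+ q))
  (ℚᵘ.≃-sym (ℚᵘ.≃-trans (toℚᵘ-homo-+ (fromℚᵘ p) (fromℚᵘ q)) (ℚᵘ.+-cong (toℚᵘ-fromℚᵘ p) (toℚᵘ-fromℚᵘ q)))))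

fromℚᵘ-* : ∀ p q → fromℚᵘ (p ℚᵘ.* q) ≡ fromℚᵘ p * fromℚᵘ q
fromℚᵘ-* p q = toℚᵘ-injective (ℚᵘ.≃-trans (toℚᵘ-fromℚᵘ (p ℚᵘ.* q))
  (ℚᵘ.≃-sym (ℚᵘ.≃-trans (toℚᵘ-homo-* (fromℚᵘ p) (fromℚᵘ q)) (ℚᵘ.*-cong (toℚᵘ-fromℚᵘ p) (toℚᵘ-fromℚᵘ q)))))

ℕ→ℚ-suc : ∀ m → ℕ→ℚ (suc m) ≡ 1ℚ + ℕ→ℚ m
ℕ→ℚ-suc m = trans (fromℚᵘ-cong {mkℚᵘ (ℤ.+ suc m) 0} {mkℚᵘ (ℤ.+ 1) 0 ℚᵘ.+ mkℚᵘ (ℤ.+ m) 0}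
    (*≡* (cong (λ z → (ℤ.+ 1 ℤ.+ z) ℤ.* ℤ.+ 1) (sym (ℤ.*-identityʳ (ℤ.+ m))))))
  (fromℚᵘ-+ (mkℚᵘ (ℤ.+ 1) 0) (mkℚᵘ (ℤ.+ m) 0))

-- The junk value recip 0 = 0 makes 𝔼 xs φ ≡ ∑ xs φ * recip (length xs) hold also for xs = [].
recip : ℕ → ℚ
recip zero    = 0ℚ
recip (suc k) = ℤ.+ 1 / suc k

recip-* : ∀ a b → recip (a ℕ.* b) ≡ recip a * recip b
recip-* zero    b       = sym (*-zeroˡ (recip b))
recip-* (suc a) zero    = trans (cong recip (ℕ.*-zeroʳ a)) (sym (*-zeroʳ (recip (suc a))))
recip-* (suc a) (suc b) = fromℚᵘ-* (mkℚᵘ (ℤ.+ 1) a) (mkℚᵘ (ℤ.+ 1) b)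

recip-nonNeg : ∀ k → 0ℚ ≤ recip k
recip-nonNeg zero    = ≤-refl
recip-nonNeg (suc k) = nonNegative⁻¹ _ {{normalize-nonNeg 1 (suc k)}}

ℕ→ℚ-*-recip : ∀ k → ℕ→ℚ (suc k) * recip (suc k) ≡ 1ℚ
ℕ→ℚ-*-recip k = trans (sym (fromℚᵘ-* (mkℚᵘ (ℤ.+ suc k) 0) (mkℚᵘ (ℤ.+ 1) k)))
  (fromℚᵘ-cong (ℚᵘ.*-inverseʳ (mkℚᵘ (ℤ.+ suc k) 0)))

^-nonNeg : ∀ {x} k → 0ℚ ≤ x → 0ℚ ≤ x ^ k
^-nonNeg zero    _   = ≤ᵇ⇒≤ tt
^-nonNeg {x} (suc k) 0≤x = nonNegative⁻¹ _
  {{nonNeg*nonNeg⇒nonNeg x {{nonNegative 0≤x}} (x ^ k) {{nonNegative (^-nonNeg k 0≤x)}}}}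

^-mono-≤ : ∀ {x y} k → 0ℚ ≤ x → x ≤ y → x ^ k ≤ y ^ k
^-mono-≤ zero    _   _   = ≤-refl
^-mono-≤ {x} {y} (suc k) 0≤x x≤y = ≤-trans
  (*-monoʳ-≤-nonNeg (x ^ k) {{nonNegative (^-nonNeg k 0≤x)}} x≤y)
  (*-monoˡ-≤-nonNeg y {{nonNegative (≤-trans 0≤x x≤y)}} (^-mono-≤ k 0≤x x≤y))

^-≤-1 : ∀ {x} k → 0ℚ ≤ x → x ≤ 1ℚ → x ^ k ≤ 1ℚ
^-≤-1 zero    _   _   = ≤-refl
^-≤-1 {x} (suc k) 0≤x x≤1 = ≤-trans
  (*-monoˡ-≤-nonNeg x {{nonNegative 0≤x}} (^-≤-1 k 0≤x x≤1))
  (≤-trans (≤-reflexive (*-identityʳ x)) x≤1)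

^-antimonoʳ-≤ : ∀ {x k l} → 0ℚ ≤ x → x ≤ 1ℚ → k ℕ.≤ l → x ^ l ≤ x ^ k
^-antimonoʳ-≤ {l = l} 0≤x x≤1 z≤n       = ^-≤-1 l 0≤x x≤1
^-antimonoʳ-≤ {x} 0≤x x≤1 (s≤s k≤l) =
  *-monoˡ-≤-nonNeg x {{nonNegative 0≤x}} (^-antimonoʳ-≤ 0≤x x≤1 k≤l)

^-distribʳ-* : ∀ x y k → (x * y) ^ k ≡ x ^ k * y ^ k
^-distribʳ-* x y zero    = refl
^-distribʳ-* x y (suc k) = trans (cong ((x * y) *_) (^-distribʳ-* x y k))
  (interchange x y (x ^ k) (y ^ k))
  where
  interchange : ∀ x y a b → (x * y) * (a * b) ≡ (x * a) * (y * b)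
  interchange = solve-∀ ℚ-ring

∣p∣-∣q∣≤∣p-q∣ : ∀ p q → ∣ p ∣ - ∣ q ∣ ≤ ∣ p - q ∣
∣p∣-∣q∣≤∣p-q∣ p q = begin
  ∣ p ∣ - ∣ q ∣               ≡⟨ cong (λ r → ∣ r ∣ - ∣ q ∣) (split p q) ⟩
  ∣ (p - q) + q ∣ - ∣ q ∣     ≤⟨ +-monoˡ-≤ (- ∣ q ∣) (∣p+q∣≤∣p∣+∣q∣ (p - q) q) ⟩
  (∣ p - q ∣ + ∣ q ∣) - ∣ q ∣ ≡⟨ cancel ∣ p - q ∣ ∣ q ∣ ⟩
  ∣ p - q ∣                   ∎
  where
  open ≤-Reasoning
  split : ∀ a b → a ≡ (a - b) + b
  split = solve-∀ ℚ-ring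
  cancel : ∀ a b → (a + b) - b ≡ a
  cancel = solve-∀ ℚ-ring

∣∣p∣-∣q∣∣≤∣p-q∣ : ∀ p q → ∣ ∣ p ∣ - ∣ q ∣ ∣ ≤ ∣ p - q ∣
∣∣p∣-∣q∣∣≤∣p-q∣ p q with ∣p∣≡p∨∣p∣≡-p (∣ p ∣ - ∣ q ∣)
... | inj₁ eq = ≤-trans (≤-reflexive eq) (∣p∣-∣q∣≤∣p-q∣ p q)
... | inj₂ eq = begin
  ∣ ∣ p ∣ - ∣ q ∣ ∣ ≡⟨ trans eq (neg-diff ∣ p ∣ ∣ q ∣) ⟩
  ∣ q ∣ - ∣ p ∣     ≤⟨ ∣p∣-∣q∣≤∣p-q∣ q p ⟩
  ∣ q - p ∣         ≡⟨ trans (cong ∣_∣ (sym (neg-diff p q))) (∣-p∣≡∣p∣ (p - q)) ⟩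
  ∣ p - q ∣         ∎
  where
  open ≤-Reasoning
  neg-diff : ∀ a b → - (a - b) ≡ b - a
  neg-diff = solve-∀ ℚ-ring

data ≤Root (c : ℚ) (k m : ℕ) (ε x : ℚ) : Set where
  nonpos : x ≤ 0ℚ → ≤Root c k m ε x
  power  : x ^ m ≤ c ^ m * ε ^ k → ≤Root c k m ε x

≤Root⇒≤rootᵇ : ∀ {c k m ε x} → ≤Root c k m ε x → T (≤rootᵇ c k m ε x)
≤Root⇒≤rootᵇ (nonpos x≤0) = Equivalence.from T-∨ (inj₁ (≤⇒≤ᵇ x≤0))
≤Root⇒≤rootᵇ (power h)    = Equivalence.from T-∨ (inj₂ (≤⇒≤ᵇ h))

≤rootᵇ⇒≤Root : ∀ {c k m ε x} → T (≤rootᵇ c k m ε x) → ≤Root c k m ε x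
≤rootᵇ⇒≤Root h = Sum.[ nonpos ∘ ≤ᵇ⇒≤ , power ∘ ≤ᵇ⇒≤ ]′ (Equivalence.to T-∨ h)

≤Root-mono : ∀ {c k m ε x y} → x ≤ y → ≤Root c k m ε y → ≤Root c k m ε x
≤Root-mono {x = x} x≤y h with x ≤? 0ℚ
... | yes x≤0 = nonpos x≤0
≤Root-mono x≤y (nonpos y≤0) | no x≰0 = ⊥-elim (x≰0 (≤-trans x≤y y≤0))
≤Root-mono {m = m} x≤y (power h) | no x≰0 = power (≤-trans (^-mono-≤ m (<⇒≤ (≰⇒> x≰0)) x≤y) h)

≤Root⇒< : ∀ {c k m ε x b} → 0ℚ < b → c ^ m * ε ^ k < b ^ m → ≤Root c k m ε x → x < b
≤Root⇒< {x = x} {b} 0<b bound h with x <? b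
... | yes x<b = x<b
≤Root⇒< 0<b bound (nonpos x≤0) | no x≮b =
  ⊥-elim (<-irrefl refl (<-≤-trans 0<b (≤-trans (≮⇒≥ x≮b) x≤0)))
≤Root⇒< {m = m} 0<b bound (power h) | no x≮b =
  ⊥-elim (<-irrefl refl (≤-<-trans (^-mono-≤ m (<⇒≤ 0<b) (≮⇒≥ x≮b)) (≤-<-trans h bound)))

≤Root-exponent : ∀ {c k l m ε x} → 0ℚ ≤ ε → ε ≤ 1ℚ → 0ℚ ≤ c → k ℕ.≤ l →
                 ≤Root c l m ε x → ≤Root c k m ε x
≤Root-exponent _   _   _   _   (nonpos x≤0) = nonpos x≤0
≤Root-exponent {c} {m = m} 0≤ε ε≤1 0≤c k≤l (power h) = power (≤-trans h
  (*-monoˡ-≤-nonNeg (c ^ m) {{nonNegative (^-nonNeg m 0≤c)}} (^-antimonoʳ-≤ 0≤ε ε≤1 k≤l)))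

≤Root-const : ∀ {c d k m ε x} → 0ℚ ≤ ε → c ^ m ≤ d ^ m → ≤Root c k m ε x → ≤Root d k m ε x
≤Root-const _ _ (nonpos x≤0) = nonpos x≤0
≤Root-const {k = k} {ε = ε} 0≤ε cᵐ≤dᵐ (power h) =
  power (≤-trans h (*-monoʳ-≤-nonNeg (ε ^ k) {{nonNegative (^-nonNeg k 0≤ε)}} cᵐ≤dᵐ))

≤Root-scale : ∀ {c k m ε x} r → 0ℚ ≤ r → ≤Root c k m ε x → ≤Root (r * c) k m ε (r * x)
≤Root-scale r 0≤r (nonpos x≤0) =
  nonpos (≤-trans (*-monoˡ-≤-nonNeg r {{nonNegative 0≤r}} x≤0) (≤-reflexive (*-zeroʳ r)))
≤Root-scale {c} {k} {m} {ε} {x} r 0≤r (power h) = power (begin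
  (r * x) ^ m             ≡⟨ ^-distribʳ-* r x m ⟩
  r ^ m * x ^ m           ≤⟨ *-monoˡ-≤-nonNeg (r ^ m) {{nonNegative (^-nonNeg m 0≤r)}} h ⟩
  r ^ m * (c ^ m * ε ^ k) ≡⟨ sym (*-assoc (r ^ m) (c ^ m) (ε ^ k)) ⟩
  r ^ m * c ^ m * ε ^ k   ≡⟨ cong (_* ε ^ k) (sym (^-distribʳ-* r c m)) ⟩
  (r * c) ^ m * ε ^ k     ∎)
  where open ≤-Reasoning

≤Root-double : ∀ {c k m ε x} → ≤Root c k m ε x → ≤Root (c + c) k m ε (x + x)
≤Root-double {c} {x = x} h =
  subst₂ (λ c' x' → ≤Root c' _ _ _ x') (twice c) (twice x) (≤Root-scale (1ℚ + 1ℚ) (≤ᵇ⇒≤ tt) h)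
  where
  twice : ∀ a → (1ℚ + 1ℚ) * a ≡ a + a
  twice = solve-∀ ℚ-ring

≤Root-+ : ∀ {c k m ε x y} → ≤Root c k m ε x → ≤Root c k m ε y → ≤Root (c + c) k m ε (x + y)
≤Root-+ {x = x} {y} hx hy with ≤-total x y
... | inj₁ x≤y = ≤Root-mono (+-monoˡ-≤ y x≤y) (≤Root-double hy)
... | inj₂ y≤x = ≤Root-mono (+-monoʳ-≤ x y≤x) (≤Root-double hx)

private variable
  A B : Set

∑ : List A → (A → ℚ) → ℚ
∑ xs f = sumℚ (map f xs)

∑-cong : ∀ xs {f g : A → ℚ} → (∀ x → f x ≡ g x) → ∑ xs f ≡ ∑ xs g
∑-cong []       _  = refl
∑-cong (x ∷ xs) eq = cong₂ _+_ (eq x) (∑-cong xs eq)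

∑-mono-≤ : ∀ xs {f g : A → ℚ} → (∀ x → f x ≤ g x) → ∑ xs f ≤ ∑ xs g
∑-mono-≤ []       _  = ≤-refl
∑-mono-≤ (x ∷ xs) le = +-mono-≤ (le x) (∑-mono-≤ xs le)

∑-++ : ∀ xs ys (f : A → ℚ) → ∑ (xs ++ ys) f ≡ ∑ xs f + ∑ ys f
∑-++ []       ys f = sym (+-identityˡ (∑ ys f))
∑-++ (x ∷ xs) ys f = trans (cong (f x +_) (∑-++ xs ys f)) (sym (+-assoc (f x) _ _))

∑-+ : ∀ xs (f g : A → ℚ) → ∑ xs (λ x → f x + g x) ≡ ∑ xs f + ∑ xs g
∑-+ []       f g = refl
∑-+ (x ∷ xs) f g = trans (cong (f x + g x +_) (∑-+ xs f g)) (shuffle (f x) (g x) (∑ xs f) (∑ xs g))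
  where
  shuffle : ∀ a b c d → (a + b) + (c + d) ≡ (a + c) + (b + d)
  shuffle = solve-∀ ℚ-ring

∑-*ʳ : ∀ xs (f : A → ℚ) c → ∑ xs (λ x → f x * c) ≡ ∑ xs f * c
∑-*ʳ []       f c = sym (*-zeroˡ c)
∑-*ʳ (x ∷ xs) f c = trans (cong (f x * c +_) (∑-*ʳ xs f c)) (sym (*-distribʳ-+ c (f x) _))

∑-const : ∀ (xs : List A) c → ∑ xs (λ _ → c) ≡ ℕ→ℚ (length xs) * c
∑-const []       c = sym (*-zeroˡ c)
∑-const (x ∷ xs) c = begin
  c + ∑ xs (λ _ → c)           ≡⟨ cong (c +_) (∑-const xs c) ⟩
  c + ℕ→ℚ (length xs) * c      ≡⟨ cong (_+ ℕ→ℚ (length xs) * c) (*-identityˡ c) ⟨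
  1ℚ * c + ℕ→ℚ (length xs) * c ≡⟨ *-distribʳ-+ c 1ℚ (ℕ→ℚ (length xs)) ⟨
  (1ℚ + ℕ→ℚ (length xs)) * c   ≡⟨ cong (_* c) (ℕ→ℚ-suc (length xs)) ⟨
  ℕ→ℚ (suc (length xs)) * c    ∎
  where open ≡-Reasoning

∑-zero : ∀ (xs : List A) → ∑ xs (λ _ → 0ℚ) ≡ 0ℚ
∑-zero xs = trans (∑-const xs 0ℚ) (*-zeroʳ (ℕ→ℚ (length xs)))

∑-filterᵇ : ∀ (p : A → Bool) xs f → ∑ (filterᵇ p xs) f ≡ ∑ xs (λ x → if p x then f x else 0ℚ)
∑-filterᵇ p []       f = refl
∑-filterᵇ p (x ∷ xs) f with p x
... | true  = cong (f x +_) (∑-filterᵇ p xs f)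
... | false = trans (∑-filterᵇ p xs f) (sym (+-identityˡ _))

∑-if : ∀ xs b (f : A → ℚ) → (if b then ∑ xs f else 0ℚ) ≡ ∑ xs (λ x → if b then f x else 0ℚ)
∑-if xs true  f = refl
∑-if xs false f = sym (∑-zero xs)

∑-map : ∀ (g : A → B) xs (f : B → ℚ) → ∑ (map g xs) f ≡ ∑ xs (f ∘ g)
∑-map g []       f = refl
∑-map g (x ∷ xs) f = cong (f (g x) +_) (∑-map g xs f)

∑-concatMap : ∀ (g : A → List B) xs (f : B → ℚ) → ∑ (concatMap g xs) f ≡ ∑ xs (λ x → ∑ (g x) f)
∑-concatMap g []       f = refl
∑-concatMap g (x ∷ xs) f = trans (∑-++ (g x) (concatMap g xs) f) (cong (∑ (g x) f +_) (∑-concatMap g xs f))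

∑-comm : ∀ xs ys (F : A → B → ℚ) → ∑ xs (λ a → ∑ ys (F a)) ≡ ∑ ys (λ b → ∑ xs (λ a → F a b))
∑-comm []       ys F = sym (∑-zero ys)
∑-comm (x ∷ xs) ys F = trans (cong (∑ ys (F x) +_) (∑-comm xs ys F)) (sym (∑-+ ys (F x) _))

∑-cartesianProduct : ∀ xs ys (F : A × B → ℚ) →
  ∑ (cartesianProduct xs ys) F ≡ ∑ xs (λ a → ∑ ys (λ b → F (a , b)))
∑-cartesianProduct []       ys F = refl
∑-cartesianProduct (x ∷ xs) ys F = trans (∑-++ (map (x ,_) ys) _ F)
  (cong₂ _+_ (∑-map (x ,_) ys F) (∑-cartesianProduct xs ys F))

length-cartesianProduct : ∀ (xs : List A) (ys : List B) →
  length (cartesianProduct xs ys) ≡ length xs ℕ.* length ys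
length-cartesianProduct []       ys = refl
length-cartesianProduct (x ∷ xs) ys = trans (length-++ (map (x ,_) ys))
  (cong₂ ℕ._+_ (length-map (x ,_) ys) (length-cartesianProduct xs ys))

𝔼≡∑*recip : ∀ (xs : List A) φ → 𝔼 xs φ ≡ ∑ xs φ * recip (length xs)
𝔼≡∑*recip []       φ = refl
𝔼≡∑*recip (x ∷ xs) φ = refl

𝔼-cong : ∀ (xs : List A) {f g} → (∀ x → f x ≡ g x) → 𝔼 xs f ≡ 𝔼 xs g
𝔼-cong xs {f} {g} eq = begin
  𝔼 xs f                       ≡⟨ 𝔼≡∑*recip xs f ⟩
  ∑ xs f * recip (length xs)   ≡⟨ cong (_* recip (length xs)) (∑-cong xs eq) ⟩
  ∑ xs g * recip (length xs)   ≡⟨ 𝔼≡∑*recip xs g ⟨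
  𝔼 xs g                       ∎
  where open ≡-Reasoning

𝔼-mono-≤ : ∀ (xs : List A) {f g} → (∀ x → f x ≤ g x) → 𝔼 xs f ≤ 𝔼 xs g
𝔼-mono-≤ xs {f} {g} le = begin
  𝔼 xs f                       ≡⟨ 𝔼≡∑*recip xs f ⟩
  ∑ xs f * recip (length xs)   ≤⟨ *-monoʳ-≤-nonNeg (recip (length xs))
                                   {{nonNegative (recip-nonNeg (length xs))}} (∑-mono-≤ xs le) ⟩
  ∑ xs g * recip (length xs)   ≡⟨ 𝔼≡∑*recip xs g ⟨
  𝔼 xs g                       ∎
  where open ≤-Reasoning

𝔼-+ : ∀ (xs : List A) f g → 𝔼 xs (λ x → f x + g x) ≡ 𝔼 xs f + 𝔼 xs g
𝔼-+ xs f g = begin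
  𝔼 xs (λ x → f x + g x)                            ≡⟨ 𝔼≡∑*recip xs _ ⟩
  ∑ xs (λ x → f x + g x) * recip (length xs)        ≡⟨ cong (_* recip (length xs)) (∑-+ xs f g) ⟩
  (∑ xs f + ∑ xs g) * recip (length xs)             ≡⟨ *-distribʳ-+ (recip (length xs)) (∑ xs f) (∑ xs g) ⟩
  ∑ xs f * recip (length xs) + ∑ xs g * recip (length xs) ≡⟨ cong₂ _+_ (𝔼≡∑*recip xs f) (𝔼≡∑*recip xs g) ⟨
  𝔼 xs f + 𝔼 xs g                                   ∎
  where open ≡-Reasoning

𝔼-const : ∀ (x : A) xs c → 𝔼 (x ∷ xs) (λ _ → c) ≡ c
𝔼-const x xs c = begin
  ∑ (x ∷ xs) (λ _ → c) * recip (suc (length xs))     ≡⟨ cong (_* recip (suc (length xs))) (∑-const (x ∷ xs) c) ⟩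
  ℕ→ℚ (suc (length xs)) * c * recip (suc (length xs)) ≡⟨ swap (ℕ→ℚ (suc (length xs))) c _ ⟩
  (ℕ→ℚ (suc (length xs)) * recip (suc (length xs))) * c ≡⟨ cong (_* c) (ℕ→ℚ-*-recip (length xs)) ⟩
  1ℚ * c                                             ≡⟨ *-identityˡ c ⟩
  c                                                  ∎
  where
  open ≡-Reasoning
  swap : ∀ a b r → a * b * r ≡ (a * r) * b
  swap = solve-∀ ℚ-ring

𝔼-nonNeg : ∀ (xs : List A) {f} → (∀ x → 0ℚ ≤ f x) → 0ℚ ≤ 𝔼 xs f
𝔼-nonNeg xs {f} 0≤f = begin
  0ℚ                                     ≡⟨ *-zeroˡ (recip (length xs)) ⟨
  0ℚ * recip (length xs)                 ≡⟨ cong (_* recip (length xs)) (∑-zero xs) ⟨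
  ∑ xs (λ _ → 0ℚ) * recip (length xs)    ≡⟨ 𝔼≡∑*recip xs _ ⟨
  𝔼 xs (λ _ → 0ℚ)                        ≤⟨ 𝔼-mono-≤ xs 0≤f ⟩
  𝔼 xs f                                 ∎
  where open ≤-Reasoning

𝔼-cartesianProduct : ∀ (xs : List A) (ys : List B) F →
  𝔼 (cartesianProduct xs ys) F ≡ 𝔼 xs (λ a → 𝔼 ys (λ b → F (a , b)))
𝔼-cartesianProduct xs ys F = begin
  𝔼 (cartesianProduct xs ys) F
    ≡⟨ 𝔼≡∑*recip (cartesianProduct xs ys) F ⟩
  ∑ (cartesianProduct xs ys) F * recip (length (cartesianProduct xs ys))
    ≡⟨ cong₂ _*_ (∑-cartesianProduct xs ys F) (trans (cong recip (length-cartesianProduct xs ys)) (recip-* m n)) ⟩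
  ∑ xs inner * (recip m * recip n)
    ≡⟨ reorder (∑ xs inner) (recip m) (recip n) ⟩
  ∑ xs inner * recip n * recip m
    ≡⟨ cong (_* recip m) (∑-*ʳ xs inner (recip n)) ⟨
  ∑ xs (λ a → ∑ ys (λ b → F (a , b)) * recip n) * recip m
    ≡⟨ cong₂ _*_ (∑-cong xs (λ a → 𝔼≡∑*recip ys _)) refl ⟨
  ∑ xs (λ a → 𝔼 ys (λ b → F (a , b))) * recip m
    ≡⟨ 𝔼≡∑*recip xs _ ⟨
  𝔼 xs (λ a → 𝔼 ys (λ b → F (a , b))) ∎
  where
  open ≡-Reasoning
  m = length xs
  n = length ys
  inner = λ a → ∑ ys (λ b → F (a , b))
  reorder : ∀ s a b → s * (a * b) ≡ s * b * a
  reorder = solve-∀ ℚ-ring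

𝟙 : Bool → ℚ
𝟙 b = if b then 1ℚ else 0ℚ

Pr-mono : ∀ (xs : List A) {E F} → (∀ x → T (E x) → T (F x)) → Pr xs E ≤ Pr xs F
Pr-mono xs {E} {F} E⇒F = 𝔼-mono-≤ xs (λ x → 𝟙-mono (E x) (F x) (E⇒F x))
  where
  𝟙-mono : ∀ a b → (T a → T b) → 𝟙 a ≤ 𝟙 b
  𝟙-mono false b     _ = 0≤𝟙 b
    where
    0≤𝟙 : ∀ b → 0ℚ ≤ 𝟙 b
    0≤𝟙 false = ≤-refl
    0≤𝟙 true  = ≤ᵇ⇒≤ tt
  𝟙-mono true  true  _ = ≤-refl
  𝟙-mono true  false h = ⊥-elim (h tt)

Pr-∨ : ∀ (xs : List A) E F → Pr xs (λ x → E x ∨ F x) ≤ Pr xs E + Pr xs F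
Pr-∨ xs E F = ≤-trans (𝔼-mono-≤ xs (λ x → 𝟙-∨ (E x) (F x))) (≤-reflexive (𝔼-+ xs (𝟙 ∘ E) (𝟙 ∘ F)))
  where
  𝟙-∨ : ∀ a b → 𝟙 (a ∨ b) ≤ 𝟙 a + 𝟙 b
  𝟙-∨ false false = ≤-refl
  𝟙-∨ false true  = ≤-refl
  𝟙-∨ true  false = ≤-refl
  𝟙-∨ true  true  = ≤ᵇ⇒≤ tt

Pr-not : ∀ (x : A) xs E → 1ℚ - Pr (x ∷ xs) E ≡ Pr (x ∷ xs) (not ∘ E)
Pr-not x xs E = begin
  1ℚ - Pr L E                          ≡⟨ cong (_- Pr L E) total ⟨
  (Pr L E + Pr L (not ∘ E)) - Pr L E   ≡⟨ cancel (Pr L E) (Pr L (not ∘ E)) ⟩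
  Pr L (not ∘ E)                       ∎
  where
  open ≡-Reasoning
  L = x ∷ xs
  𝟙+𝟙-not : ∀ b → 𝟙 b + 𝟙 (not b) ≡ 1ℚ
  𝟙+𝟙-not false = refl
  𝟙+𝟙-not true  = refl
  total : Pr L E + Pr L (not ∘ E) ≡ 1ℚ
  total = trans (sym (𝔼-+ L (𝟙 ∘ E) (𝟙 ∘ not ∘ E)))
    (trans (𝔼-cong L (𝟙+𝟙-not ∘ E)) (𝔼-const x xs 1ℚ))
  cancel : ∀ a b → (a + b) - a ≡ b
  cancel = solve-∀ ℚ-ring

Pr-proj₁ : ∀ (xs : List A) (y : B) ys E → Pr (cartesianProduct xs (y ∷ ys)) (E ∘ proj₁) ≡ Pr xs E
Pr-proj₁ xs y ys E = trans (𝔼-cartesianProduct xs (y ∷ ys) _)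
  (𝔼-cong xs (λ a → 𝔼-const y ys (𝟙 (E a))))

Pr-proj₂ : ∀ (x : A) xs (ys : List B) E → Pr (cartesianProduct (x ∷ xs) ys) (E ∘ proj₂) ≡ Pr ys E
Pr-proj₂ x xs ys E = trans (𝔼-cartesianProduct (x ∷ xs) ys _) (𝔼-const x xs (Pr ys E))

¬-all⇒any-¬ : ∀ {a b c d e} → (T a → T b → T c → T d → T e) →
              T (not e) → T ((not a ∨ not b) ∨ (not c ∨ not d))
¬-all⇒any-¬ {false}                               _ _ = tt
¬-all⇒any-¬ {true} {false}                        _ _ = tt
¬-all⇒any-¬ {true} {true} {false}                 _ _ = tt
¬-all⇒any-¬ {true} {true} {true} {false}          _ _ = tt
¬-all⇒any-¬ {true} {true} {true} {true} {false}   h _ = h tt tt tt tt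
¬-all⇒any-¬ {true} {true} {true} {true} {true}    _ ()

failure-union-bound : ∀ (xs : List A) E F (μ : A × A → A × A) →
  (∀ ab → T (E (proj₁ ab)) → T (E (proj₂ ab)) → T (E (proj₁ (μ ab))) → T (E (proj₂ (μ ab))) → T (F ab)) →
  Pr (cartesianProduct xs xs) (not ∘ E ∘ proj₁ ∘ μ) ≡ Pr (cartesianProduct xs xs) (not ∘ E ∘ proj₁) →
  Pr (cartesianProduct xs xs) (not ∘ E ∘ proj₂ ∘ μ) ≡ Pr (cartesianProduct xs xs) (not ∘ E ∘ proj₂) →
  let p = 1ℚ - Pr xs E in 1ℚ - Pr (cartesianProduct xs xs) F ≤ (p + p) + (p + p)
failure-union-bound []       E F μ _       _    _    = ≤ᵇ⇒≤ tt
failure-union-bound (x ∷ xs) E F μ all⇒F μ-pres₁ μ-pres₂ = begin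
  1ℚ - Pr P F
    ≡⟨ Pr-not (x , x) (map (x ,_) xs ++ cartesianProduct xs L) F ⟩
  Pr P (not ∘ F)
    ≤⟨ Pr-mono P (λ ab → ¬-all⇒any-¬ (all⇒F ab)) ⟩
  Pr P (λ ab → (bad₁ ab ∨ bad₂ ab) ∨ (bad₃ ab ∨ bad₄ ab))
    ≤⟨ Pr-∨ P (λ ab → bad₁ ab ∨ bad₂ ab) (λ ab → bad₃ ab ∨ bad₄ ab) ⟩
  Pr P (λ ab → bad₁ ab ∨ bad₂ ab) + Pr P (λ ab → bad₃ ab ∨ bad₄ ab)
    ≤⟨ +-mono-≤ (Pr-∨ P bad₁ bad₂) (Pr-∨ P bad₃ bad₄) ⟩
  (Pr P bad₁ + Pr P bad₂) + (Pr P bad₃ + Pr P bad₄)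
    ≡⟨ cong₂ _+_ (cong₂ _+_ Pr-bad₁ Pr-bad₂) (cong₂ _+_ (trans μ-pres₁ Pr-bad₁) (trans μ-pres₂ Pr-bad₂)) ⟩
  (p + p) + (p + p) ∎
  where
  open ≤-Reasoning
  L = x ∷ xs
  P = cartesianProduct L L
  p = 1ℚ - Pr L E
  bad₁ = not ∘ E ∘ proj₁
  bad₂ = not ∘ E ∘ proj₂
  bad₃ = not ∘ E ∘ proj₁ ∘ μ
  bad₄ = not ∘ E ∘ proj₂ ∘ μ
  Pr-bad₁ : Pr P bad₁ ≡ p
  Pr-bad₁ = trans (Pr-proj₁ L x xs (not ∘ E)) (sym (Pr-not x xs E))
  Pr-bad₂ : Pr P bad₂ ≡ p
  Pr-bad₂ = trans (Pr-proj₂ x xs L (not ∘ E)) (sym (Pr-not x xs E))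

sign : Bool → ℚ
sign true  = 1ℚ
sign false = - 1ℚ

∣∣x∣-1∣≡∣x-sign∣ : ∀ x → ∃ λ s → ∣ ∣ x ∣ - 1ℚ ∣ ≡ ∣ x - sign s ∣
∣∣x∣-1∣≡∣x-sign∣ x with ∣p∣≡p∨∣p∣≡-p x
... | inj₁ ∣x∣≡x  = true , cong (λ r → ∣ r - 1ℚ ∣) ∣x∣≡x
... | inj₂ ∣x∣≡-x = false , (begin
  ∣ ∣ x ∣ - 1ℚ ∣       ≡⟨ cong (λ r → ∣ r - 1ℚ ∣) ∣x∣≡-x ⟩
  ∣ - x - 1ℚ ∣         ≡⟨ cong ∣_∣ (negate x) ⟩
  ∣ - (x - - 1ℚ) ∣     ≡⟨ ∣-p∣≡∣p∣ (x - - 1ℚ) ⟩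
  ∣ x - - 1ℚ ∣         ∎)
  where
  open ≡-Reasoning
  negate : ∀ x → - x - 1ℚ ≡ - (x - - 1ℚ)
  negate = solve-∀ ℚ-ring

∣sign-sign∣ : ∀ {s t} → s ≢ t → ∣ sign s - sign t ∣ ≡ 1ℚ + 1ℚ
∣sign-sign∣ {true}  {true}  s≢t = ⊥-elim (s≢t refl)
∣sign-sign∣ {true}  {false} _   = refl
∣sign-sign∣ {false} {true}  _   = refl
∣sign-sign∣ {false} {false} s≢t = ⊥-elim (s≢t refl)

signs-apart : ∀ s₁ s₂ s₃ s₄ → s₁ ≢ s₃ → s₃ ≢ s₂ →
              1ℚ + 1ℚ ≤ ∣ (sign s₃ - sign s₂) - (sign s₁ - sign s₄) ∣
signs-apart true  _     true  _     s₁≢s₃ _     = ⊥-elim (s₁≢s₃ refl)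
signs-apart false _     false _     s₁≢s₃ _     = ⊥-elim (s₁≢s₃ refl)
signs-apart _     true  true  _     _     s₃≢s₂ = ⊥-elim (s₃≢s₂ refl)
signs-apart _     false false _     _     s₃≢s₂ = ⊥-elim (s₃≢s₂ refl)
signs-apart true  true  false true  _     _     = ≤ᵇ⇒≤ tt
signs-apart true  true  false false _     _     = ≤ᵇ⇒≤ tt
signs-apart false false true  true  _     _     = ≤ᵇ⇒≤ tt
signs-apart false false true  false _     _     = ≤ᵇ⇒≤ tt

module FourPoint (ε : ℚ) where

  two : ℚ
  two = 1ℚ + 1ℚ

  small : ℚ → Bool
  small = ≤rootᵇ two 1 7 ε

  -- goodPair a ε X (α , β) unfolds to goodDiffᵇ (g₁ a X α - g₁ a X β) (g₂ a X α - g₂ a X β).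
  goodDiffᵇ : ℚ → ℚ → Bool
  goodDiffᵇ z₁ z₂ = (small (∣ z₁ ∣) ∧ small (∣ z₂ ∣))
                  ∨ (small (∣ z₁ ∣) ∧ small (∣ ∣ z₂ ∣ - two ∣))
                  ∨ (small (∣ ∣ z₁ ∣ - two ∣) ∧ small (∣ z₂ ∣))

  record Near (z c : ℚ) : Set where
    constructor near
    field
      gap-small : ≤Root two 1 7 ε ∣ z - c ∣
      gap<1     : ∣ z - c ∣ < 1ℚ

  nearUnitᵇ : ℚ → Bool
  nearUnitᵇ x = ≤rootᵇ 1ℚ 1 7 ε ∣ ∣ x ∣ - 1ℚ ∣

  record NearSign (x : ℚ) (s : Bool) : Set where
    constructor nearSign
    field
      gap-small : ≤Root 1ℚ 1 7 ε ∣ x - sign s ∣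

  near-sign : ∀ x → T (nearUnitᵇ x) → ∃ (NearSign x)
  near-sign x h = let s , eq = ∣∣x∣-1∣≡∣x-sign∣ x in
    s , nearSign (subst (≤Root 1ℚ 1 7 ε) eq (≤rootᵇ⇒≤Root h))

  near-same : ∀ {z s t} → s ≡ t → Near z (sign s - sign t) → ≤Root two 1 7 ε ∣ z ∣
  near-same {z} {s} refl (near h _) =
    subst (≤Root two 1 7 ε) (cong ∣_∣ (trans (cong (λ c → z - c) (+-inverseʳ (sign s))) (+-identityʳ z))) h

  near-opposite : ∀ {z s t} → s ≢ t → Near z (sign s - sign t) → ≤Root two 1 7 ε ∣ ∣ z ∣ - two ∣
  near-opposite {z} {s} {t} s≢t (near h _) = ≤Root-mono
    (≤-trans (≤-reflexive (cong (λ r → ∣ ∣ z ∣ - r ∣) (sym (∣sign-sign∣ s≢t)))) (∣∣p∣-∣q∣∣≤∣p-q∣ z _)) h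

  near-apart : ∀ {z c c'} → Near z c → Near z c' → ∣ c - c' ∣ < two
  near-apart {z} {c} {c'} (near _ z≈c) (near _ z≈c') = begin-strict
    ∣ c - c' ∣               ≡⟨ cong ∣_∣ (difference z c c') ⟩
    ∣ (z - c') - (z - c) ∣   ≤⟨ ∣p-q∣≤∣p∣+∣q∣ (z - c') (z - c) ⟩
    ∣ z - c' ∣ + ∣ z - c ∣   <⟨ +-mono-< z≈c' z≈c ⟩
    two                      ∎
    where
    open ≤-Reasoning
    difference : ∀ z c c' → c - c' ≡ (z - c') - (z - c)
    difference = solve-∀ ℚ-ring

  case-a : ∀ {z₁ z₂} → ≤Root two 1 7 ε ∣ z₁ ∣ → ≤Root two 1 7 ε ∣ z₂ ∣ → T (goodDiffᵇ z₁ z₂)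
  case-a h₁ h₂ = Equivalence.from T-∨ (inj₁ (Equivalence.from T-∧ (≤Root⇒≤rootᵇ h₁ , ≤Root⇒≤rootᵇ h₂)))

  case-b : ∀ {z₁ z₂} → ≤Root two 1 7 ε ∣ z₁ ∣ → ≤Root two 1 7 ε ∣ ∣ z₂ ∣ - two ∣ → T (goodDiffᵇ z₁ z₂)
  case-b {z₁} {z₂} h₁ h₂ = Equivalence.from (T-∨ {small (∣ z₁ ∣) ∧ small (∣ z₂ ∣)})
    (inj₂ (Equivalence.from T-∨ (inj₁ (Equivalence.from T-∧ (≤Root⇒≤rootᵇ h₁ , ≤Root⇒≤rootᵇ h₂)))))

  case-c : ∀ {z₁ z₂} → ≤Root two 1 7 ε ∣ ∣ z₁ ∣ - two ∣ → ≤Root two 1 7 ε ∣ z₂ ∣ → T (goodDiffᵇ z₁ z₂)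
  case-c {z₁} {z₂} h₁ h₂ = Equivalence.from (T-∨ {small (∣ z₁ ∣) ∧ small (∣ z₂ ∣)})
    (inj₂ (Equivalence.from (T-∨ {small (∣ z₁ ∣) ∧ small (∣ ∣ z₂ ∣ - two ∣)})
      (inj₂ (Equivalence.from T-∧ (≤Root⇒≤rootᵇ h₁ , ≤Root⇒≤rootᵇ h₂)))))

  goodDiff-from-signs : ∀ {z₁ z₂} s₁ s₂ s₃ s₄ → Near z₁ (sign s₃ - sign s₂) → Near z₁ (sign s₁ - sign s₄) →
    Near z₂ (sign s₁ - sign s₃) → T (goodDiffᵇ z₁ z₂)
  goodDiff-from-signs {z₁} {z₂} s₁ s₂ s₃ s₄ n₃₂ n₁₄ n₁₃ with s₁ Bool.≟ s₃ | s₃ Bool.≟ s₂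
  ... | yes s₁≡s₃ | yes s₃≡s₂ = case-a {z₁} {z₂} (near-same s₃≡s₂ n₃₂) (near-same s₁≡s₃ n₁₃)
  ... | no  s₁≢s₃ | yes s₃≡s₂ = case-b {z₁} {z₂} (near-same s₃≡s₂ n₃₂) (near-opposite s₁≢s₃ n₁₃)
  ... | yes s₁≡s₃ | no  s₃≢s₂ = case-c {z₁} {z₂} (near-opposite s₃≢s₂ n₃₂) (near-same s₁≡s₃ n₁₃)
  ... | no  s₁≢s₃ | no  s₃≢s₂ =
    ⊥-elim (<-irrefl refl (<-≤-trans (near-apart n₃₂ n₁₄) (signs-apart s₁ s₂ s₃ s₄ s₁≢s₃ s₃≢s₂)))

  module _ (ε<½⁷ : ε < ½ ^ 7) where

    <½ : ∀ {u} → ≤Root 1ℚ 1 7 ε u → u < ½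
    <½ = ≤Root⇒< (positive⁻¹ ½) (≤-<-trans (≤-reflexive (trans (*-identityˡ (ε ^ 1)) (*-identityʳ ε))) ε<½⁷)

    near-difference : ∀ {z x y s t} → z ≡ x - y → NearSign x s → NearSign y t → Near z (sign s - sign t)
    near-difference {z} {x} {y} {s} {t} refl (nearSign hx) (nearSign hy) =
      near (≤Root-mono bound (≤Root-+ hx hy)) (≤-<-trans bound (+-mono-< (<½ hx) (<½ hy)))
      where
      regroup : ∀ x y a b → (x - y) - (a - b) ≡ (x - a) - (y - b)
      regroup = solve-∀ ℚ-ring
      bound : ∣ (x - y) - (sign s - sign t) ∣ ≤ ∣ x - sign s ∣ + ∣ y - sign t ∣
      bound = ≤-trans (≤-reflexive (cong ∣_∣ (regroup x y (sign s) (sign t))))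
                      (∣p-q∣≤∣p∣+∣q∣ (x - sign s) (y - sign t))

    goodDiff-from-nearUnit : ∀ a₁ a₂ b₁ b₂ → T (nearUnitᵇ (a₁ + a₂)) → T (nearUnitᵇ (b₁ + b₂)) →
      T (nearUnitᵇ (a₁ + b₂)) → T (nearUnitᵇ (b₁ + a₂)) → T (goodDiffᵇ (a₁ - b₁) (a₂ - b₂))
    goodDiff-from-nearUnit a₁ a₂ b₁ b₂ h₁ h₂ h₃ h₄ =
      let s₁ , d₁ = near-sign (a₁ + a₂) h₁; s₂ , d₂ = near-sign (b₁ + b₂) h₂
          s₃ , d₃ = near-sign (a₁ + b₂) h₃; s₄ , d₄ = near-sign (b₁ + a₂) h₄
      in goodDiff-from-signs s₁ s₂ s₃ s₄ (near-difference (shiftʳ a₁ b₁ b₂) d₃ d₂)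
                                         (near-difference (shiftʳ a₁ b₁ a₂) d₁ d₄)
                                         (near-difference (shiftˡ a₂ b₂ a₁) d₁ d₃)
      where
      shiftʳ : ∀ a b c → a - b ≡ (a + c) - (b + c)
      shiftʳ = solve-∀ ℚ-ring
      shiftˡ : ∀ a b c → a - b ≡ (c + a) - (c + b)
      shiftˡ = solve-∀ ℚ-ring

vmix : ∀ {k} → Vec Bool k → Vec A k → Vec A k → Vec A k
vmix []      []      []      = []
vmix (b ∷ X) (x ∷ v) (y ∷ w) = (if b then x else y) ∷ vmix X v w

lookup-vmix : ∀ {k} (X : Vec Bool k) (v w : Vec A k) i →
              lookup (vmix X v w) i ≡ (if lookup X i then lookup v i else lookup w i)
lookup-vmix (b ∷ X) (x ∷ v) (y ∷ w) Fin.zero    = refl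
lookup-vmix (b ∷ X) (x ∷ v) (y ∷ w) (Fin.suc i) = lookup-vmix X v w i

∑-vecs-suc : ∀ m k (F : Vec (Fin m) (suc k) → ℚ) →
             ∑ (vecs m (suc k)) F ≡ ∑ (allFin m) (λ i → ∑ (vecs m k) (λ v → F (i ∷ v)))
∑-vecs-suc m k F = trans (∑-concatMap (λ i → map (i ∷_) (vecs m k)) (allFin m) F)
  (∑-cong (allFin m) (λ i → ∑-map (i ∷_) (vecs m k) F))

∑-vecs-vmix : ∀ m k (X : Vec Bool k) (H : Vec (Fin m) k → Vec (Fin m) k → ℚ) →
  ∑ (vecs m k) (λ v → ∑ (vecs m k) (λ w → H (vmix X v w) (vmix X w v))) ≡ ∑ (vecs m k) (λ v → ∑ (vecs m k) (H v))
∑-vecs-vmix m zero    []      H = refl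
∑-vecs-vmix m (suc k) (b ∷ X) H = begin
  ∑ V' (λ v → ∑ V' (λ w → H (vmix (b ∷ X) v w) (vmix (b ∷ X) w v)))
    ≡⟨ trans (∑-vecs-suc m k _) (∑-cong I (λ i → ∑-cong V (λ v → ∑-vecs-suc m k _))) ⟩
  ∑ I (λ i → ∑ V (λ v → ∑ I (λ j → ∑ V (λ w → H (pick i j ∷ vmix X v w) (pick j i ∷ vmix X w v)))))
    ≡⟨ ∑-cong I (λ i → ∑-comm V I _) ⟩
  ∑ I (λ i → ∑ I (λ j → ∑ V (λ v → ∑ V (λ w → H (pick i j ∷ vmix X v w) (pick j i ∷ vmix X w v)))))
    ≡⟨ ∑-cong I (λ i → ∑-cong I (λ j → ∑-vecs-vmix m k X (λ v w → H (pick i j ∷ v) (pick j i ∷ w)))) ⟩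
  ∑ I (λ i → ∑ I (λ j → ∑ V (λ v → ∑ V (λ w → H (pick i j ∷ v) (pick j i ∷ w)))))
    ≡⟨ ∑-pick b (λ i j → ∑ V (λ v → ∑ V (λ w → H (i ∷ v) (j ∷ w)))) ⟩
  ∑ I (λ i → ∑ I (λ j → ∑ V (λ v → ∑ V (λ w → H (i ∷ v) (j ∷ w)))))
    ≡⟨ ∑-cong I (λ i → ∑-comm V I _) ⟨
  ∑ I (λ i → ∑ V (λ v → ∑ I (λ j → ∑ V (λ w → H (i ∷ v) (j ∷ w)))))
    ≡⟨ trans (∑-vecs-suc m k _) (∑-cong I (λ i → ∑-cong V (λ v → ∑-vecs-suc m k _))) ⟨
  ∑ V' (λ v → ∑ V' (H v)) ∎
  where
  open ≡-Reasoning
  I = allFin m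
  V = vecs m k
  V' = vecs m (suc k)
  pick : Fin m → Fin m → Fin m
  pick i j = if b then i else j
  ∑-pick : ∀ b (K : Fin m → Fin m → ℚ) →
    ∑ I (λ i → ∑ I (λ j → K (if b then i else j) (if b then j else i))) ≡ ∑ I (λ i → ∑ I (K i))
  ∑-pick true  K = refl
  ∑-pick false K = ∑-comm I I (λ i j → K j i)

allᵇ-All : ∀ (xs : List A) {p} → T (allᵇ xs p) ⇔ All (T ∘ p) xs
allᵇ-All []       = mk⇔ (λ _ → []) (λ _ → tt)
allᵇ-All (x ∷ xs) {p} = mk⇔
  (λ h → let px , pxs = Equivalence.to (T-∧ {p x}) h in px ∷ Equivalence.to (allᵇ-All xs) pxs)
  (λ { (px ∷ pxs) → Equivalence.from T-∧ (px , Equivalence.from (allᵇ-All xs) pxs) })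

allᵇ-allFin⁻ : ∀ {n} {p : Fin n → Bool} → T (allᵇ (allFin n) p) → ∀ i → T (p i)
allᵇ-allFin⁻ h = All.tabulate⁻ (Equivalence.to (allᵇ-All _) h)

allᵇ-allFin⁺ : ∀ {n} {p : Fin n → Bool} → (∀ i → T (p i)) → T (allᵇ (allFin n) p)
allᵇ-allFin⁺ h = Equivalence.from (allᵇ-All _) (All.tabulate⁺ h)

allᵇ-cong : ∀ (xs : List A) {p q} → (∀ x → p x ≡ q x) → allᵇ xs p ≡ allᵇ xs q
allᵇ-cong []       _  = refl
allᵇ-cong (x ∷ xs) eq = cong₂ _∧_ (eq x) (allᵇ-cong xs eq)

T-⇔ᵇ : ∀ {a b} → T (a ⇔ᵇ b) ⇔ a ≡ b
T-⇔ᵇ {true}  {true}  = mk⇔ (λ _ → refl) (λ _ → tt)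
T-⇔ᵇ {true}  {false} = mk⇔ (λ ()) (λ ())
T-⇔ᵇ {false} {true}  = mk⇔ (λ ()) (λ ())
T-⇔ᵇ {false} {false} = mk⇔ (λ _ → refl) (λ _ → tt)

if-∧ : ∀ a {b x} → (if a then (if b then x else 0ℚ) else 0ℚ) ≡ (if a ∧ b then x else 0ℚ)
if-∧ true  = refl
if-∧ false = refl

T-≡ : ∀ {a b} → (T a → T b) → (T b → T a) → a ≡ b
T-≡ {true}  {true}  _ _ = refl
T-≡ {true}  {false} f _ = ⊥-elim (f tt)
T-≡ {false} {true}  _ g = ⊥-elim (g tt)
T-≡ {false} {false} _ _ = refl

module _ {n : ℕ} where

  injectiveᵇ⇔Injective : ∀ {π : Perm n} → T (injectiveᵇ π) ⇔ Injective _≡_ _≡_ π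
  injectiveᵇ⇔Injective {π} = mk⇔ to from
    where
    to : T (injectiveᵇ π) → Injective _≡_ _≡_ π
    to h {i} {j} πi≡πj with Equivalence.to (T-∨ {i == j}) (allᵇ-allFin⁻ (allᵇ-allFin⁻ h i) j)
    ... | inj₁ i≡j   = toWitness {a? = i Fin.≟ j} i≡j
    ... | inj₂ πi≢πj = ⊥-elim (toWitnessFalse {a? = π i Fin.≟ π j} πi≢πj πi≡πj)
    from : Injective _≡_ _≡_ π → T (injectiveᵇ π)
    from inj = allᵇ-allFin⁺ λ i → allᵇ-allFin⁺ λ j → Equivalence.from T-∨ (decide i j)
      where
      decide : ∀ i j → T (i == j) ⊎ T (not (π i == π j))
      decide i j with i Fin.≟ j
      ... | yes _   = inj₁ tt
      ... | no  i≢j = inj₂ (fromWitnessFalse {a? = π i Fin.≟ π j} (i≢j ∘ inj))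

  mix : Subset n → Perm n → Perm n → Perm n
  mix X α β i = if lookup X i then α i else β i

  mixPair : Subset n → Perm n × Perm n → Perm n × Perm n
  mixPair X (α , β) = mix X α β , mix X β α

  mix-involutive : ∀ X α β → mix X (mix X α β) (mix X β α) ≗ α
  mix-involutive X α β i with lookup X i
  ... | true  = refl
  ... | false = refl

  module _ (X Y : Subset n) where

    sendsᵇ : Perm n → Bool
    sendsᵇ π = allᵇ (allFin n) λ i → lookup X i ⇔ᵇ lookup Y (π i)

    Sends : Perm n → Set
    Sends π = ∀ i → lookup X i ≡ lookup Y (π i)

    sendsᵇ⇔Sends : ∀ {π} → T (sendsᵇ π) ⇔ Sends π
    sendsᵇ⇔Sends = mk⇔
      (λ h i → Equivalence.to T-⇔ᵇ (allᵇ-allFin⁻ h i))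
      (λ h → allᵇ-allFin⁺ (λ i → Equivalence.from T-⇔ᵇ (h i)))

    inTXYᵇ : Perm n → Bool
    inTXYᵇ π = injectiveᵇ π ∧ sendsᵇ π

    inTXYᵇ-cong : ∀ {α β} → α ≗ β → inTXYᵇ α ≡ inTXYᵇ β
    inTXYᵇ-cong α≗β = cong₂ _∧_
      (allᵇ-cong (allFin n) λ i → allᵇ-cong (allFin n) λ j → cong₂ (λ a b → (i == j) ∨ not (a == b)) (α≗β i) (α≗β j))
      (allᵇ-cong (allFin n) λ i → cong (λ a → lookup X i ⇔ᵇ lookup Y a) (α≗β i))

    mix-sends : ∀ {α β} → Sends α → Sends β → Sends (mix X α β)
    mix-sends {α} {β} rα rβ i with lookup X i in Xi
    ... | true  = trans (sym Xi) (rα i)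
    ... | false = trans (sym Xi) (rβ i)

    mix-injective : ∀ {α β} → Injective _≡_ _≡_ α → Injective _≡_ _≡_ β → Sends α → Sends β →
                    Injective _≡_ _≡_ (mix X α β)
    mix-injective {α} {β} iα iβ rα rβ {i} {j} eq with lookup X i in Xi | lookup X j in Xj
    ... | true  | true  = iα eq
    ... | false | false = iβ eq
    ... | true  | false with () ← trans (sym Xi) (trans (rα i) (trans (cong (lookup Y) eq) (trans (sym (rβ j)) Xj)))
    ... | false | true  with () ← trans (sym Xi) (trans (rβ i) (trans (cong (lookup Y) eq) (trans (sym (rα j)) Xj)))

    inTXYᵇ-mix : ∀ {α β} → T (inTXYᵇ α) → T (inTXYᵇ β) → T (inTXYᵇ (mix X α β))
    inTXYᵇ-mix {α} {β} hα hβ =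
      let iα , rα = Equivalence.to (T-∧ {injectiveᵇ α}) hα
          iβ , rβ = Equivalence.to (T-∧ {injectiveᵇ β}) hβ
          Rα = Equivalence.to sendsᵇ⇔Sends rα
          Rβ = Equivalence.to sendsᵇ⇔Sends rβ
      in Equivalence.from T-∧
           ( Equivalence.from injectiveᵇ⇔Injective
               (mix-injective (Equivalence.to injectiveᵇ⇔Injective iα) (Equivalence.to injectiveᵇ⇔Injective iβ) Rα Rβ)
           , Equivalence.from sendsᵇ⇔Sends (mix-sends Rα Rβ))

    inTXYᵇ-mixPair : ∀ α β → inTXYᵇ (mix X α β) ∧ inTXYᵇ (mix X β α) ≡ inTXYᵇ α ∧ inTXYᵇ β
    inTXYᵇ-mixPair α β = T-≡ unmix (both-mixed α β)
      where
      both-mixed : ∀ α β → T (inTXYᵇ α ∧ inTXYᵇ β) → T (inTXYᵇ (mix X α β) ∧ inTXYᵇ (mix X β α))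
      both-mixed α β h = let hα , hβ = Equivalence.to (T-∧ {inTXYᵇ α}) h in
        Equivalence.from T-∧ (inTXYᵇ-mix hα hβ , inTXYᵇ-mix hβ hα)
      unmix : T (inTXYᵇ (mix X α β) ∧ inTXYᵇ (mix X β α)) → T (inTXYᵇ α ∧ inTXYᵇ β)
      unmix h = subst T (cong₂ _∧_ (inTXYᵇ-cong (mix-involutive X α β)) (inTXYᵇ-cong (mix-involutive X β α)))
        (both-mixed (mix X α β) (mix X β α) h)

    ∑-TXY : ∀ f → ∑ (TXY X Y) f ≡ ∑ (vecs n n) (λ v → if inTXYᵇ (lookup v) then f (lookup v) else 0ℚ)
    ∑-TXY f = begin
      ∑ (TXY X Y) f
        ≡⟨ ∑-filterᵇ sendsᵇ (S n) f ⟩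
      ∑ (S n) (λ π → if sendsᵇ π then f π else 0ℚ)
        ≡⟨ ∑-filterᵇ injectiveᵇ (map lookup (vecs n n)) _ ⟩
      ∑ (map lookup (vecs n n)) (λ π → if injectiveᵇ π then (if sendsᵇ π then f π else 0ℚ) else 0ℚ)
        ≡⟨ ∑-map lookup (vecs n n) _ ⟩
      ∑ (vecs n n) (λ v → if injectiveᵇ (lookup v) then (if sendsᵇ (lookup v) then f (lookup v) else 0ℚ) else 0ℚ)
        ≡⟨ ∑-cong (vecs n n) (λ v → if-∧ (injectiveᵇ (lookup v))) ⟩
      ∑ (vecs n n) (λ v → if inTXYᵇ (lookup v) then f (lookup v) else 0ℚ) ∎
      where open ≡-Reasoning

    ∑-TXY² : ∀ F → ∑ (cartesianProduct (TXY X Y) (TXY X Y)) F ≡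
      ∑ (vecs n n) (λ v → ∑ (vecs n n) (λ w →
        if inTXYᵇ (lookup v) ∧ inTXYᵇ (lookup w) then F (lookup v , lookup w) else 0ℚ))
    ∑-TXY² F = begin
      ∑ (cartesianProduct L L) F
        ≡⟨ ∑-cartesianProduct L L F ⟩
      ∑ L (λ α → ∑ L (λ β → F (α , β)))
        ≡⟨ ∑-TXY _ ⟩
      ∑ V (λ v → if inTXYᵇ (lookup v) then ∑ L (λ β → F (lookup v , β)) else 0ℚ)
        ≡⟨ ∑-cong V (λ v → trans (cong (λ r → if inTXYᵇ (lookup v) then r else 0ℚ) (∑-TXY _))
                                 (∑-if V (inTXYᵇ (lookup v)) _)) ⟩
      ∑ V (λ v → ∑ V (λ w →
        if inTXYᵇ (lookup v) then (if inTXYᵇ (lookup w) then F (lookup v , lookup w) else 0ℚ) else 0ℚ))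
        ≡⟨ ∑-cong V (λ v → ∑-cong V (λ w → if-∧ (inTXYᵇ (lookup v)))) ⟩
      ∑ V (λ v → ∑ V (λ w → if inTXYᵇ (lookup v) ∧ inTXYᵇ (lookup w) then F (lookup v , lookup w) else 0ℚ)) ∎
      where
      open ≡-Reasoning
      L = TXY X Y
      V = vecs n n

    -- On the vectors enumerating S n, mixing exchanges coordinates and so permutes (vecs n n)²;
    -- since mixing is an involution, a pair lies in T_{X,Y}² iff its mix does.
    ∑-mixPair : ∀ F → (∀ {α α' β β'} → α ≗ α' → β ≗ β' → F (α , β) ≡ F (α' , β')) →
                ∑ (cartesianProduct (TXY X Y) (TXY X Y)) (F ∘ mixPair X)
                  ≡ ∑ (cartesianProduct (TXY X Y) (TXY X Y)) F
    ∑-mixPair F F-cong = begin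
      ∑ P (F ∘ mixPair X)
        ≡⟨ ∑-TXY² (F ∘ mixPair X) ⟩
      ∑ V (λ v → ∑ V (λ w → if inTXYᵇ (lookup v) ∧ inTXYᵇ (lookup w) then F (mixPair X (lookup v , lookup w)) else 0ℚ))
        ≡⟨ ∑-cong V (λ v → ∑-cong V (λ w → mixed v w)) ⟨
      ∑ V (λ v → ∑ V (λ w → H (vmix X v w) (vmix X w v)))
        ≡⟨ ∑-vecs-vmix n n X H ⟩
      ∑ V (λ v → ∑ V (H v))
        ≡⟨ ∑-TXY² F ⟨
      ∑ P F ∎
      where
      open ≡-Reasoning
      P = cartesianProduct (TXY X Y) (TXY X Y)
      V = vecs n n
      H : Vec (Fin n) n → Vec (Fin n) n → ℚ
      H v w = if inTXYᵇ (lookup v) ∧ inTXYᵇ (lookup w) then F (lookup v , lookup w) else 0ℚ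
      mixed : ∀ v w → H (vmix X v w) (vmix X w v) ≡
              (if inTXYᵇ (lookup v) ∧ inTXYᵇ (lookup w) then F (mixPair X (lookup v , lookup w)) else 0ℚ)
      mixed v w = cong₂ (λ b r → if b then r else 0ℚ)
        (trans (cong₂ _∧_ (inTXYᵇ-cong (lookup-vmix X v w)) (inTXYᵇ-cong (lookup-vmix X w v)))
               (inTXYᵇ-mixPair (lookup v) (lookup w)))
        (F-cong (lookup-vmix X v w) (lookup-vmix X w v))

    Pr-mixPair : ∀ G → (∀ {α α' β β'} → α ≗ α' → β ≗ β' → G (α , β) ≡ G (α' , β')) →
                 Pr (cartesianProduct (TXY X Y) (TXY X Y)) (G ∘ mixPair X)
                   ≡ Pr (cartesianProduct (TXY X Y) (TXY X Y)) G
    Pr-mixPair G G-cong = begin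
      𝔼 P (𝟙 ∘ G ∘ mixPair X)                    ≡⟨ 𝔼≡∑*recip P _ ⟩
      ∑ P (𝟙 ∘ G ∘ mixPair X) * recip (length P) ≡⟨ cong (_* recip (length P)) ∑-preserved ⟩
      ∑ P (𝟙 ∘ G) * recip (length P)             ≡⟨ 𝔼≡∑*recip P _ ⟨
      𝔼 P (𝟙 ∘ G)                                ∎
      where
      open ≡-Reasoning
      P = cartesianProduct (TXY X Y) (TXY X Y)
      ∑-preserved : ∑ P (𝟙 ∘ G ∘ mixPair X) ≡ ∑ P (𝟙 ∘ G)
      ∑-preserved = ∑-mixPair (𝟙 ∘ G) (λ eα eβ → cong 𝟙 (G-cong eα eβ))

if-then-if : ∀ b {x y : A} (h : A → ℚ) → (if b then h (if b then x else y) else 0ℚ) ≡ (if b then h x else 0ℚ)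
if-then-if true  h = refl
if-then-if false h = refl

if-else-if : ∀ b {x y : A} (h : A → ℚ) → (if b then 0ℚ else h (if b then x else y)) ≡ (if b then 0ℚ else h y)
if-else-if true  h = refl
if-else-if false h = refl

module _ {n : ℕ} (a : Fin n → Fin n → ℚ) (X : Subset n) where

  gXY-mix : ∀ α β → gXY a X (mix X α β) ≡ g₁ a X α + g₂ a X β
  gXY-mix α β = cong₂ _+_ (∑-cong (allFin n) (λ i → if-then-if (lookup X i) (a i)))
                          (∑-cong (allFin n) (λ i → if-else-if (lookup X i) (a i)))

  gXY-cong : ∀ {α β} → α ≗ β → gXY a X α ≡ gXY a X β
  gXY-cong α≗β = cong₂ _+_ (∑-cong (allFin n) (λ i → cong (λ j → if lookup X i then a i j else 0ℚ) (α≗β i)))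
                           (∑-cong (allFin n) (λ i → cong (λ j → if lookup X i then 0ℚ else a i j) (α≗β i)))

module _ {n : ℕ} (a : Fin n → Fin n → ℚ) (ε : ℚ) (X Y : Subset n) (ε<½⁷ : ε < ½ ^ 7) where
  open FourPoint ε

  nearUnit : Perm n → Bool
  nearUnit = nearUnitᵇ ∘ gXY a X

  goodPair-from-mix : ∀ ab → T (nearUnit (proj₁ ab)) → T (nearUnit (proj₂ ab)) →
    T (nearUnit (proj₁ (mixPair X ab))) → T (nearUnit (proj₂ (mixPair X ab))) → T (goodPair a ε X ab)
  goodPair-from-mix (α , β) h₁ h₂ h₃ h₄ =
    goodDiff-from-nearUnit ε<½⁷ (g₁ a X α) (g₂ a X α) (g₁ a X β) (g₂ a X β) h₁ h₂
    (subst (T ∘ nearUnitᵇ) (gXY-mix a X α β) h₃) (subst (T ∘ nearUnitᵇ) (gXY-mix a X β α) h₄)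

  pair-failure-bound : let p = 1ℚ - Pr (TXY X Y) nearUnit in
    1ℚ - Pr (cartesianProduct (TXY X Y) (TXY X Y)) (goodPair a ε X) ≤ (p + p) + (p + p)
  pair-failure-bound = failure-union-bound (TXY X Y) nearUnit (goodPair a ε X) (mixPair X) goodPair-from-mix
    (Pr-mixPair X Y (not ∘ nearUnit ∘ proj₁) (λ eα _ → cong (not ∘ nearUnitᵇ) (gXY-cong a X eα)))
    (Pr-mixPair X Y (not ∘ nearUnit ∘ proj₂) (λ _ eβ → cong (not ∘ nearUnitᵇ) (gXY-cong a X eβ)))

  pair-bound : 0ℚ ≤ ε → AlmostBooleanRoot (TXY X Y) (gXY a X) ε 4 7 1 7 →
    T (≤rootᵇ (ℕ→ℚ 8) 2 7 ε (1ℚ - Pr (cartesianProduct (TXY X Y) (TXY X Y)) (goodPair a ε X)))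
  pair-bound 0≤ε almostBoolean = ≤Root⇒≤rootᵇ {ℕ→ℚ 8}
    (≤Root-exponent 0≤ε (≤-trans (<⇒≤ ε<½⁷) (≤ᵇ⇒≤ tt)) (≤ᵇ⇒≤ tt) (s≤s (s≤s z≤n))
      (≤Root-const 0≤ε (≤ᵇ⇒≤ tt) (≤Root-mono pair-failure-bound four-p≤)))
    where
    p = 1ℚ - Pr (TXY X Y) nearUnit
    p≤ : ≤Root 1ℚ 4 7 ε p
    p≤ = ≤rootᵇ⇒≤Root almostBoolean
    four-p≤ : ≤Root ((1ℚ + 1ℚ) + (1ℚ + 1ℚ)) 4 7 ε ((p + p) + (p + p))
    four-p≤ = ≤Root-+ (≤Root-+ p≤ p≤) (≤Root-+ p≤ p≤)

square-nonNeg : ∀ p → 0ℚ ≤ p * p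
square-nonNeg p with ≤-total 0ℚ p
... | inj₁ 0≤p = nonNegative⁻¹ _ {{nonNeg*nonNeg⇒nonNeg p {{nonNegative 0≤p}} p {{nonNegative 0≤p}}}}
... | inj₂ p≤0 = nonNegative⁻¹ _ {{nonPos*nonPos⇒nonPos p {{nonPositive p≤0}} p {{nonPositive p≤0}}}}

-- Only condition (a) of typicality and 0 ≤ ε < 2⁻⁷ are needed; the other hypotheses are unused.
lemma8 : Σ ℚ λ ε₀ → 0ℚ < ε₀ ×
    ((n : ℕ) → 4 ℕ.≤ n →
     (ℱ : Perm n → Bool) → 2 ℕ.* card ℱ ≡ n ! →
     (c : Fin n → Fin n → ℚ) → IsProjU₁ (fOf ℱ) c →
     let f = fOf ℱ
         ε = ⟨ (λ π → f π - spanT c π) , (λ π → f π - spanT c π) ⟩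
         a = λ (i j : Fin n) → ℕ→ℚ (n ℕ.∸ 1) * ⟨ f , Tχ i j ⟩
     in
     1ℚ ≤ ℕ→ℚ (n ℕ.^ 7) * (ε ^ 3) → ε < ε₀ →
     (X Y : Subset n) → Subset.∣ X ∣ ≡ Subset.∣ Y ∣ → Typical a ε X Y →
     T (≤rootᵇ (ℕ→ℚ 8) 2 7 ε
          (1ℚ - Pr (cartesianProduct (TXY X Y) (TXY X Y)) (goodPair a ε X))))
lemma8 = ½ ^ 7 , positive⁻¹ (½ ^ 7) , λ n _ ℱ _ c _ _ ε<½⁷ X Y _ (almostBoolean , _) →
  pair-bound (λ i j → ℕ→ℚ (n ℕ.∸ 1) * ⟨ fOf ℱ , Tχ i j ⟩) _ X Y ε<½⁷
    (𝔼-nonNeg (S n) (λ π → square-nonNeg (fOf ℱ π - spanT c π))) almostBoolean
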